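{- $\mathrm{NONPALINDROME}\in\mathrm{BNAL}[\log n]$, where $\mathrm{NONPALINDROME}=\{0,1\}^*\setminus\{x\in\{0,1\}^*: x_i=x_{|x|-i+1}\text{ for all }i\}$.
   Context: Convolution pairs strings symbol by symbol, padding shorter ones with a new symbol $\#$; a relation is automatic if the set of convolutions of its tuples is regular; it is bounded if there is a constant $c$ with $||y|-|x||\le c$ for all $(x,y)$ in it. A Nondeterministic Automatic Register Machine (NARM) has finitely many registers holding strings over a finite alphabet $\Gamma\supseteq\Sigma$ (initially empty) and a finite program: read input into a register, write, assign a constant string, copy, assign to a register a value related by a bounded automatic relation to (the convolution of) registers (nondeterministic choice), goto, conditional goto on an automatic predicate, halt/accept/reject; each executed instruction is one step. An input is accepted iff some computation path accepts. $\mathrm{BNAL}[f(n)]$ is the class of languages accepted by a NARM with all accepting paths on inputs of length $n$ taking $O(f(n))$ steps. -}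

module Defs where

open import Data.Nat using (ℕ; zero; suc; _+_; _*_; _≤_; _⊔_)
open import Data.Nat.Logarithm using (⌊log₂_⌋)
open import Data.Fin using (Fin; zero; suc; opposite; _≟_)
open import Data.Bool using (Bool; true; false; if_then_else_)
open import Data.Maybe using (Maybe; just; nothing)
open import Data.List as List using (List; []; _∷_; length; foldl; lookup)
open import Data.Vec as Vec using (Vec; []; _∷_)
open import Data.Product using (Σ; ∃; _×_; _,_)
open import Function.Bundles using (_⇔_)
open import Relation.Nullary using (¬_; does)
open import Relation.Binary.PropositionalEquality using (_≡_)

record DFA (A : Set) : Set where
  field
    Q      : ℕ
    start  : Fin Q
    δ      : Fin Q → A → Fin Q
    final  : Fin Q → Bool

accepts : ∀ {A} → DFA A → List A → Bool
accepts M u = DFA.final M (foldl (DFA.δ M) (DFA.start M) u)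

-- Convolution: pad with the new symbol # (= nothing)

head? : ∀ {A : Set} → List A → Maybe A
head? []      = nothing
head? (a ∷ _) = just a

tail' : ∀ {A : Set} → List A → List A
tail' []       = []
tail' (_ ∷ as) = as

maxLen : ∀ {A : Set} {k} → Vec (List A) k → ℕ
maxLen []       = 0
maxLen (x ∷ xs) = length x ⊔ maxLen xs

conv' : ∀ {A : Set} {k} → ℕ → Vec (List A) k → List (Vec (Maybe A) k)
conv' zero    xs = []
conv' (suc n) xs = Vec.map head? xs ∷ conv' n (Vec.map tail' xs)

conv : ∀ {A : Set} {k} → Vec (List A) k → List (Vec (Maybe A) k)
conv xs = conv' (maxLen xs) xs

-- A (k+1)-ary automatic relation R(y, x₁..x_k) given by a DFA on convolutions;
-- bounded (as a relation between x = conv(x₁..x_k) and y): ||y| - |x|| ≤ c.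
BoundedAut : ∀ {A : Set} {k} → DFA (Vec (Maybe A) (suc k)) → Set
BoundedAut {A} {k} M = ∃ λ c → ∀ (y : List A) (xs : Vec (List A) k) →
  accepts M (conv (y ∷ xs)) ≡ true →
  (length y ≤ maxLen xs + c) × (maxLen xs ≤ length y + c)

-- NARM instructions.  Γ = Fin (2 + g), Σ = {0,1} ↪ Γ;
-- r registers; program labels Fin (suc L).

Γ : ℕ → Set
Γ g = Fin (suc (suc g))

emb : ∀ {g} → Bool → Γ g
emb false = zero
emb true  = suc zero

data Instr (g r L : ℕ) : Set where
  read    : Fin r → Instr g r L
  write   : Fin r → Instr g r L                          -- output R_i (no effect on acceptance)
  const   : Fin r → List (Γ g) → Instr g r L
  copy    : Fin r → Fin r → Instr g r L
  rel     : Fin r → (k : ℕ) → Vec (Fin r) k →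
            (M : DFA (Vec (Maybe (Γ g)) (suc k))) →
            BoundedAut M → Instr g r L
  goto    : Fin (suc L) → Instr g r L
  ifgoto  : (k : ℕ) → Vec (Fin r) k →
            DFA (Vec (Maybe (Γ g)) k) → Fin (suc L) → Instr g r L
  halt    : Instr g r L
  accept  : Instr g r L
  reject  : Instr g r L

record NARM : Set where
  field
    g r L : ℕ
    prog  : Fin (suc L) → Instr g r L

next : ∀ {n} → Fin n → Maybe (Fin n)
next {suc zero}    zero    = nothing
next {suc (suc n)} zero    = just (suc zero)
next {suc (suc n)} (suc i) = Data.Maybe.map suc (next i)

module Run (N : NARM) (w : List Bool) where
  open NARM N

  Regs : Set
  Regs = Fin r → List (Γ g)

  upd : Regs → Fin r → List (Γ g) → Regs
  upd ρ i v j = if does (i ≟ j) then v else ρ j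

  Config : Set
  Config = Fin (suc L) × Regs

  sel : ∀ {k} → Regs → Vec (Fin r) k → Vec (List (Γ g)) k
  sel ρ js = Vec.map ρ js

  -- one step; executing past the last instruction halts (no successor)
  data Step : Config → Config → Set where
    s-read  : ∀ {pc ρ i p'} → prog pc ≡ read i → next pc ≡ just p' →
              Step (pc , ρ) (p' , upd ρ i (List.map emb w))
    s-write : ∀ {pc ρ i p'} → prog pc ≡ write i → next pc ≡ just p' →
              Step (pc , ρ) (p' , ρ)
    s-const : ∀ {pc ρ i u p'} → prog pc ≡ const i u → next pc ≡ just p' →
              Step (pc , ρ) (p' , upd ρ i u)
    s-copy  : ∀ {pc ρ i j p'} → prog pc ≡ copy i j → next pc ≡ just p' →
              Step (pc , ρ) (p' , upd ρ i (ρ j))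
    s-rel   : ∀ {pc ρ i k js M b p'} (y : List (Γ g)) →
              prog pc ≡ rel i k js M b →
              accepts M (conv (y ∷ sel ρ js)) ≡ true → next pc ≡ just p' →
              Step (pc , ρ) (p' , upd ρ i y)
    s-goto  : ∀ {pc ρ l} → prog pc ≡ goto l → Step (pc , ρ) (l , ρ)
    s-if-t  : ∀ {pc ρ k js M l} → prog pc ≡ ifgoto k js M l →
              accepts M (conv (sel ρ js)) ≡ true → Step (pc , ρ) (l , ρ)
    s-if-f  : ∀ {pc ρ k js M l p'} → prog pc ≡ ifgoto k js M l →
              accepts M (conv (sel ρ js)) ≡ false → next pc ≡ just p' →
              Step (pc , ρ) (p' , ρ)

  -- accepting computation path of exactly t executed instructions
  -- (the final accept instruction counts as one step)
  data AccRun : ℕ → Config → Set where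
    done : ∀ {pc ρ} → prog pc ≡ accept → AccRun 1 (pc , ρ)
    step : ∀ {t c c'} → Step c c' → AccRun t c' → AccRun (suc t) c

  init : Config
  init = zero , λ _ → []

  Accepts : Set
  Accepts = ∃ λ t → AccRun t init

BNAL : (ℕ → ℕ) → (List Bool → Set) → Set
BNAL f Lang = Σ NARM λ N →
  (∀ w → Lang w ⇔ Run.Accepts N w) ×
  (∃ λ c → ∃ λ n₀ → ∀ w t → n₀ ≤ length w →
     Run.AccRun N w t (Run.init N w) → t ≤ c * f (length w))

NONPALINDROME : List Bool → Set
NONPALINDROME x = ¬ (∀ (i : Fin (length x)) → lookup x i ≡ lookup x (opposite i))

logn : ℕ → ℕ
logn n = ⌊log₂ n ⌋

{-# OPTIONS --safe #-}
module Submission where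

-- Guess y = L^p M^(2+k) R^s, aligned with the input x, such that the input symbols under
-- the first and the last M differ.  One automatic relation checks this shape and the
-- mismatch; the positions p and p+k+1 are mirror images exactly when s = p, i.e. when y has
-- as many L's as R's.  That equality is tested in O(log n) rounds: each round replaces y by
-- a string y′ of the same length keeping every second L and every second R (the others
-- become M).  An automaton verifies this by carrying one remainder bit per letter, so
-- #L y = 2 #L y′ + r and #R y = 2 #R y′ + r′, and it insists on r = r′; hence the counts
-- stay equal iff they were equal, and the number of L's and R's at least halves each round.
-- The input bits 0, 1 are written as L, R; only their equality ever matters.

open import Defs
open import Data.Nat using (ℕ; zero; suc; _+_; _*_; _∸_; _^_; _≤_; _<_; _⊔_; s≤s; z≤n; z<s;
                            compare; less; equal; greater)
open import Data.Nat.Properties hiding (_≟_)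
open import Data.Nat.Induction using (<-wellFounded)
open import Data.Nat.Logarithm using (⌊log₂_⌋; ⌊log₂⌋-mono-≤; ⌊log₂[2^n]⌋≡n)
open import Data.Nat.Tactic.RingSolver using (solve-∀)
open import Data.Fin using (Fin; zero; suc; #_; _≟_; toℕ; fromℕ<; opposite)
open import Data.Fin.Properties using (2↔Bool; ¬∀⟶∃¬; opposite-prop; toℕ<n; toℕ-fromℕ<)
open import Data.Bool using (Bool; true; false; not; if_then_else_)
import Data.Bool as Bool
open import Data.Maybe using (Maybe; just; nothing)
import Data.Maybe as Maybe
open import Data.Maybe.Properties using (just-injective; map-injective)
open import Data.List using (List; []; _∷_; length; foldl; replicate; _++_; lookup; map)
open import Data.List.Properties using (length-++; length-replicate; length-map)
open import Data.Vec using (Vec; []; _∷_)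
open import Data.Product using (∃; ∃₂; _×_; _,_; proj₁)
open import Data.Empty using (⊥-elim)
open import Function using (_∘_; id)
open import Function.Bundles using (_↪_; mk↪; module RightInverse; _⇔_; mk⇔; module Equivalence)
open import Function.Definitions using (Injective)
open import Function.Properties.Inverse using (↔-sym; ↔⇒↪)
open import Induction.WellFounded using (Acc; acc)
open import Relation.Nullary using (¬_; does; yes; no; contradiction)
open import Relation.Nullary.Decidable using (dec-true; dec-false)
open import Relation.Binary.PropositionalEquality

-- Automata over convolutions

module _ {A S : Set} {Q : ℕ} (S↪Q : S ↪ Fin Q) where
  open RightInverse S↪Q using (to; from; strictlyInverseʳ)

  dfa : S → (S → A → S) → (S → Bool) → DFA A
  dfa start δ final = record
    { Q = Q ; start = to start ; δ = λ q a → to (δ (from q) a) ; final = final ∘ from }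

  accepts-dfa : ∀ start δ final u → accepts (dfa start δ final) u ≡ final (foldl δ start u)
  accepts-dfa start δ final u = cong final (from-foldl start u)
    where
    from-foldl : ∀ s u → from (foldl (λ q a → to (δ (from q) a)) (to s) u) ≡ foldl δ s u
    from-foldl s []      = strictlyInverseʳ s
    from-foldl s (a ∷ u) rewrite strictlyInverseʳ s = from-foldl (δ s a) u

column₁ : ∀ {A S : Set} → (S → A → S) → S → Vec (Maybe A) 1 → S
column₁ δ s (just a ∷ [])  = δ s a
column₁ δ s (nothing ∷ []) = s

conv-run₁ : ∀ {A S : Set} (δ : S → A → S) s (y : List A) →
            foldl (column₁ δ) s (conv (y ∷ [])) ≡ foldl δ s y
conv-run₁ δ s []      = refl
conv-run₁ δ s (a ∷ y) =
  trans (cong (λ n → foldl (column₁ δ) (δ s a) (conv' n (y ∷ []))) (sym (⊔-identityʳ (length y))))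
        (conv-run₁ δ (δ s a) y)

module TwoTrack {A S : Set} (δ : S → A → A → S) (dead : S)
                (dead-absorbs : ∀ a b → δ dead a b ≡ dead) where

  column : S → Vec (Maybe A) 2 → S
  column s (just a ∷ just b ∷ []) = δ s a b
  column _ _                      = dead

  run : S → List A → List A → S
  run s (a ∷ y) (b ∷ x) = run (δ s a b) y x
  run s _       _       = s

  run-dead : ∀ y x → run dead y x ≡ dead
  run-dead (a ∷ y) (b ∷ x) rewrite dead-absorbs a b = run-dead y x
  run-dead []      _       = refl
  run-dead (_ ∷ _) []      = refl

  foldl-dead : ∀ u → foldl column dead u ≡ dead
  foldl-dead []                             = refl
  foldl-dead ((just a ∷ just b ∷ []) ∷ u)  rewrite dead-absorbs a b = foldl-dead u
  foldl-dead ((just _ ∷ nothing ∷ []) ∷ u) = foldl-dead u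
  foldl-dead ((nothing ∷ _ ∷ []) ∷ u)      = foldl-dead u

  conv-∷ : ∀ a b (y x : List A) →
           conv ((a ∷ y) ∷ (b ∷ x) ∷ []) ≡ (just a ∷ just b ∷ []) ∷ conv (y ∷ x ∷ [])
  conv-∷ a b y x = cong (λ n → (just a ∷ just b ∷ []) ∷ conv' n (y ∷ x ∷ []))
                        (cong (length y ⊔_) (sym (⊔-identityʳ (length x))))

  conv-length : ∀ s (y x : List A) → foldl column s (conv (y ∷ x ∷ [])) ≢ dead →
                length y ≡ length x
  conv-length s []      []      _     = refl
  conv-length s (a ∷ y) []      ≢dead = ⊥-elim (≢dead (foldl-dead (conv' (length y) (y ∷ [] ∷ []))))
  conv-length s []      (b ∷ x) ≢dead = ⊥-elim (≢dead (foldl-dead (conv' (length x) ([] ∷ x ∷ []))))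
  conv-length s (a ∷ y) (b ∷ x) ≢dead =
    cong suc (conv-length (δ s a b) y x (≢dead ∘ trans (cong (foldl column s) (conv-∷ a b y x))))

  conv-run : ∀ s (y x : List A) → length y ≡ length x →
             foldl column s (conv (y ∷ x ∷ [])) ≡ run s y x
  conv-run s []      []      _  = refl
  conv-run s (a ∷ y) (b ∷ x) eq =
    trans (cong (foldl column s) (conv-∷ a b y x)) (conv-run (δ s a b) y x (suc-injective eq))

module TwoTrackDFA {A S : Set} {Q : ℕ} (S↪Q : S ↪ Fin Q)
                   (δ : S → A → A → S) (dead : S) (dead-absorbs : ∀ a b → δ dead a b ≡ dead)
                   (start : S) (final : S → Bool) (dead-rejects : final dead ≡ false) where
  open TwoTrack δ dead dead-absorbs public

  automaton : DFA (Vec (Maybe A) 2)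
  automaton = dfa S↪Q start column final

  accepting⇒≢dead : ∀ {s} → final s ≡ true → s ≢ dead
  accepting⇒≢dead accepted refl with () ← trans (sym dead-rejects) accepted

  run-dead-rejects : ∀ y x → final (run dead y x) ≢ true
  run-dead-rejects y x accepted = accepting⇒≢dead accepted (run-dead y x)

  accepts-sound : ∀ y x → accepts automaton (conv (y ∷ x ∷ [])) ≡ true →
                  length y ≡ length x × final (run start y x) ≡ true
  accepts-sound y x accepted =
    same-length , trans (cong final (sym (conv-run start y x same-length))) accepted′
    where
    accepted′ : final (foldl column start (conv (y ∷ x ∷ []))) ≡ true
    accepted′ = trans (sym (accepts-dfa S↪Q start column final (conv (y ∷ x ∷ [])))) accepted
    same-length : length y ≡ length x
    same-length = conv-length start y x (accepting⇒≢dead accepted′)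

  accepts-complete : ∀ y x → length y ≡ length x → final (run start y x) ≡ true →
                     accepts automaton (conv (y ∷ x ∷ [])) ≡ true
  accepts-complete y x same-length accepted =
    trans (accepts-dfa S↪Q start column final (conv (y ∷ x ∷ [])))
          (trans (cong final (conv-run start y x same-length)) accepted)

  bounded : BoundedAut automaton
  bounded = 0 , λ { y (x ∷ []) accepted → let same-length = proj₁ (accepts-sound y x accepted) in
    ≤-reflexive (trans same-length (sym (trans (+-identityʳ _) (⊔-identityʳ _)))) ,
    ≤-reflexive (trans (⊔-identityʳ _) (trans (sym same-length) (sym (+-identityʳ _)))) }

bit : Bool → ℕ
bit false = 0
bit true  = 1

count : ∀ {A : Set} → (A → Bool) → List A → ℕ
count f []      = 0
count f (a ∷ y) = bit (f a) + count f y

count-++ : ∀ {A : Set} (f : A → Bool) u v → count f (u ++ v) ≡ count f u + count f v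
count-++ f []      v = refl
count-++ f (a ∷ u) v = trans (cong (bit (f a) +_) (count-++ f u v)) (sym (+-assoc (bit (f a)) _ _))

count-++-++ : ∀ {A : Set} (f : A → Bool) u v w →
              count f (u ++ v ++ w) ≡ count f u + (count f v + count f w)
count-++-++ f u v w = trans (count-++ f u (v ++ w)) (cong (count f u +_) (count-++ f v w))

count-replicate : ∀ {A : Set} (f : A → Bool) n a → count f (replicate n a) ≡ (if f a then n else 0)
count-replicate f zero a with f a
... | true  = refl
... | false = refl
count-replicate f (suc n) a with f a | count-replicate f n a
... | true  | ih = cong suc ih
... | false | ih = ih

G : Set
G = Γ 1

pattern L = zero
pattern R = suc zero
pattern M = suc (suc zero)

isL isR : G → Bool
isL L = true
isL _ = false
isR R = true
isR _ = false

Balanced : List G → Set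
Balanced y = count isL y ≡ count isR y

weight : List G → ℕ
weight y = count isL y + count isR y

weight≤length : ∀ y → weight y ≤ length y
weight≤length []      = z≤n
weight≤length (L ∷ y) = s≤s (weight≤length y)
weight≤length (R ∷ y) rewrite +-suc (count isL y) (count isR y) = s≤s (weight≤length y)
weight≤length (M ∷ y) = m≤n⇒m≤1+n (weight≤length y)

_!?_ : ∀ {A : Set} → List A → ℕ → Maybe A
[]      !? _     = nothing
(a ∷ _) !? zero  = just a
(_ ∷ x) !? suc i = x !? i

-- Guessing the mismatch

guess : ℕ → ℕ → ℕ → List G
guess p k s = replicate p L ++ replicate (2 + k) M ++ replicate s R

guess-length : ∀ p k s → length (guess p k s) ≡ p + (2 + k + s)
guess-length p k s = trans (length-++ (replicate p L))
  (cong₂ _+_ (length-replicate p)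
    (trans (length-++ (replicate (2 + k) M)) (cong₂ _+_ (length-replicate (2 + k)) (length-replicate s))))

guess-countL : ∀ p k s → count isL (guess p k s) ≡ p
guess-countL p k s =
  trans (count-++-++ isL (replicate p L) (replicate (2 + k) M) (replicate s R))
        (trans (cong₂ _+_ (count-replicate isL p L)
                          (cong₂ _+_ (count-replicate isL (2 + k) M) (count-replicate isL s R)))
               (+-identityʳ p))

guess-countR : ∀ p k s → count isR (guess p k s) ≡ s
guess-countR p k s =
  trans (count-++-++ isR (replicate p L) (replicate (2 + k) M) (replicate s R))
        (cong₂ _+_ (count-replicate isR p L)
                   (cong₂ _+_ (count-replicate isR (2 + k) M) (count-replicate isR s R)))

differs : G → G → Bool
differs c c₀ = not (does (c ≟ c₀))

differs⇒≢ : ∀ {c c₀} → differs c c₀ ≡ true → c ≢ c₀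
differs⇒≢ {c} {c₀} d c≡c₀ with () ← trans (sym (cong not (dec-true (c ≟ c₀) c≡c₀))) d

≢⇒differs : ∀ {c c₀} → c ≢ c₀ → differs c c₀ ≡ true
≢⇒differs {c} {c₀} c≢c₀ = cong not (dec-false (c ≟ c₀) c≢c₀)

-- In inM c₀ d, c₀ is the input symbol under the first M and d says whether the symbol under
-- the latest M differs from it.
data GuessState : Set where
  dead inL inR : GuessState
  inM          : G → Bool → GuessState

guessStep : GuessState → G → G → GuessState
guessStep inL          L _ = inL
guessStep inL          M c = inM c false
guessStep (inM c₀ _)   M c = inM c₀ (differs c c₀)
guessStep (inM _ true) R _ = inR
guessStep inR          R _ = inR
guessStep _            _ _ = dead

guessFinal : GuessState → Bool
guessFinal (inM _ d) = d
guessFinal inR       = true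
guessFinal _         = false

guessStates : GuessState ↪ Fin 9
guessStates = mk↪ {to = encode} {from = decode} λ { refl → decode-encode _ }
  where
  encode : GuessState → Fin 9
  encode dead          = # 0
  encode inL           = # 1
  encode inR           = # 2
  encode (inM L false) = # 3
  encode (inM R false) = # 4
  encode (inM M false) = # 5
  encode (inM L true)  = # 6
  encode (inM R true)  = # 7
  encode (inM M true)  = # 8
  decode : Fin 9 → GuessState
  decode zero                                                 = dead
  decode (suc zero)                                           = inL
  decode (suc (suc zero))                                     = inR
  decode (suc (suc (suc zero)))                               = inM L false
  decode (suc (suc (suc (suc zero))))                         = inM R false
  decode (suc (suc (suc (suc (suc zero)))))                   = inM M false
  decode (suc (suc (suc (suc (suc (suc zero))))))             = inM L true
  decode (suc (suc (suc (suc (suc (suc (suc zero)))))))       = inM R true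
  decode (suc (suc (suc (suc (suc (suc (suc (suc zero)))))))) = inM M true
  decode-encode : ∀ s → decode (encode s) ≡ s
  decode-encode dead          = refl
  decode-encode inL           = refl
  decode-encode inR           = refl
  decode-encode (inM L false) = refl
  decode-encode (inM R false) = refl
  decode-encode (inM M false) = refl
  decode-encode (inM L true)  = refl
  decode-encode (inM R true)  = refl
  decode-encode (inM M true)  = refl

module Guess = TwoTrackDFA guessStates guessStep dead (λ _ _ → refl) inL guessFinal refl
open Guess using (run; run-dead-rejects)

-- After the first M, at position p, the remaining input x starts at position p + 1, so
-- x !? k is the symbol under the last of k further M's.
LastDiffers : G → Bool → ℕ → List G → Set
LastDiffers c₀ d zero    x = d ≡ true
LastDiffers c₀ d (suc k) x = x !? k ≢ just c₀

lastDiffers-∷ : ∀ {c₀} d c k x → LastDiffers c₀ (differs c c₀) k x ⇔ LastDiffers c₀ d (suc k) (c ∷ x)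
lastDiffers-∷ d c zero    x = mk⇔ (λ d c≡c₀ → differs⇒≢ d (just-injective c≡c₀))
                                  (λ c≢c₀ → ≢⇒differs (c≢c₀ ∘ cong just))
lastDiffers-∷ d c (suc k) x = mk⇔ id id

runR-sound : ∀ y x → length y ≡ length x → guessFinal (run inR y x) ≡ true →
             ∃ λ s → y ≡ replicate s R
runR-sound []      []      _  _ = 0 , refl
runR-sound (R ∷ y) (c ∷ x) eq f with s , refl ← runR-sound y x (suc-injective eq) f = suc s , refl
runR-sound (L ∷ y) (c ∷ x) eq f = ⊥-elim (run-dead-rejects y x f)
runR-sound (M ∷ y) (c ∷ x) eq f = ⊥-elim (run-dead-rejects y x f)

runM-sound : ∀ c₀ d y x → length y ≡ length x → guessFinal (run (inM c₀ d) y x) ≡ true →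
             ∃₂ λ k s → y ≡ replicate k M ++ replicate s R × LastDiffers c₀ d k x
runM-sound c₀ d     []      []      _  f = 0 , 0 , refl , f
runM-sound c₀ d     (M ∷ y) (c ∷ x) eq f with runM-sound c₀ (differs c c₀) y x (suc-injective eq) f
... | k , s , refl , last = suc k , s , refl , Equivalence.to (lastDiffers-∷ d c k x) last
runM-sound c₀ true  (R ∷ y) (c ∷ x) eq f with s , refl ← runR-sound y x (suc-injective eq) f =
  0 , suc s , refl , refl
runM-sound c₀ false (R ∷ y) (c ∷ x) eq f = ⊥-elim (run-dead-rejects y x f)
runM-sound c₀ d     (L ∷ y) (c ∷ x) eq f = ⊥-elim (run-dead-rejects y x f)

runL-sound : ∀ y x → length y ≡ length x → guessFinal (run inL y x) ≡ true →
             ∃₂ λ p k → ∃ λ s → y ≡ guess p k s × x !? p ≢ x !? suc (p + k)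
runL-sound (L ∷ y) (c ∷ x) eq f with p , k , s , refl , mismatch ← runL-sound y x (suc-injective eq) f =
  suc p , k , s , refl , mismatch
runL-sound (M ∷ y) (c ∷ x) eq f with runM-sound c false y x (suc-injective eq) f
... | suc k , s , refl , mismatch = 0 , k , s , refl , mismatch ∘ sym
runL-sound (R ∷ y) (c ∷ x) eq f = ⊥-elim (run-dead-rejects y x f)

runR-complete : ∀ s x → guessFinal (run inR (replicate s R) x) ≡ true
runR-complete zero    x       = refl
runR-complete (suc s) []      = refl
runR-complete (suc s) (c ∷ x) = runR-complete s x

runM-complete : ∀ c₀ d k s x → length x ≡ k + s → LastDiffers c₀ d k x →
                guessFinal (run (inM c₀ d) (replicate k M ++ replicate s R) x) ≡ true
runM-complete c₀ d zero    zero    x       _  last = last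
runM-complete c₀ d zero    (suc s) (c ∷ x) _  refl = runR-complete s x
runM-complete c₀ d (suc k) s       (c ∷ x) eq last =
  runM-complete c₀ (differs c c₀) k s x (suc-injective eq) (Equivalence.from (lastDiffers-∷ d c k x) last)

runL-complete : ∀ p k s x → length x ≡ p + (2 + k + s) → x !? p ≢ x !? suc (p + k) →
                guessFinal (run inL (guess p k s) x) ≡ true
runL-complete zero    k s (c ∷ x) eq mismatch =
  runM-complete c false (suc k) s x (suc-injective eq) (mismatch ∘ sym)
runL-complete (suc p) k s (c ∷ x) eq mismatch = runL-complete p k s x (suc-injective eq) mismatch

guess-sound : ∀ y x → accepts Guess.automaton (conv (y ∷ x ∷ [])) ≡ true →
              length y ≡ length x × ∃₂ λ p k → ∃ λ s → y ≡ guess p k s × x !? p ≢ x !? suc (p + k)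
guess-sound y x accepted with same-length , f ← Guess.accepts-sound y x accepted =
  same-length , runL-sound y x same-length f

guess-complete : ∀ p k s x → length x ≡ p + (2 + k + s) → x !? p ≢ x !? suc (p + k) →
                 accepts Guess.automaton (conv (guess p k s ∷ x ∷ [])) ≡ true
guess-complete p k s x len mismatch =
  Guess.accepts-complete (guess p k s) x (trans (guess-length p k s) (sym len))
                         (runL-complete p k s x len mismatch)

-- Halving

carry : Bool → Bool → Bool → Maybe Bool
carry false false false = just false
carry false true  false = just true
carry true  false false = just true
carry true  true  true  = just false
carry _     _     _     = nothing

carry-sound : ∀ {p b b′ p′} → carry p b b′ ≡ just p′ → bit p + bit b ≡ 2 * bit b′ + bit p′
carry-sound {false} {false} {false} refl = refl
carry-sound {false} {true}  {false} refl = refl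
carry-sound {true}  {false} {false} refl = refl
carry-sound {true}  {true}  {true}  refl = refl

carry-chain : ∀ p b b′ {p₁} n n′ {p₂} → p + b ≡ 2 * b′ + p₁ → p₁ + n ≡ 2 * n′ + p₂ →
              p + (b + n) ≡ 2 * (b′ + n′) + p₂
carry-chain p b b′ {p₁} n n′ {p₂} e₁ e₂ = begin
  p + (b + n)            ≡⟨ +-assoc p b n ⟨
  p + b + n              ≡⟨ cong (_+ n) e₁ ⟩
  2 * b′ + p₁ + n        ≡⟨ +-assoc (2 * b′) p₁ n ⟩
  2 * b′ + (p₁ + n)      ≡⟨ cong (2 * b′ +_) e₂ ⟩
  2 * b′ + (2 * n′ + p₂) ≡⟨ +-assoc (2 * b′) (2 * n′) p₂ ⟨
  2 * b′ + 2 * n′ + p₂   ≡⟨ cong (_+ p₂) (*-distribˡ-+ 2 b′ n′) ⟨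
  2 * (b′ + n′) + p₂     ∎
  where open ≡-Reasoning

HalveState : Set
HalveState = Maybe (Bool × Bool)

halveStep : HalveState → G → G → HalveState
halveStep nothing        _  _ = nothing
halveStep (just (p , q)) a′ a = Maybe.zipWith _,_ (carry p (isL a) (isL a′)) (carry q (isR a) (isR a′))

halveFinal : HalveState → Bool
halveFinal nothing        = false
halveFinal (just (p , q)) = does (p Bool.≟ q)

halveStates : HalveState ↪ Fin 5
halveStates = mk↪ {to = encode} {from = decode} λ { refl → decode-encode _ }
  where
  encode : HalveState → Fin 5
  encode nothing                = # 0
  encode (just (false , false)) = # 1
  encode (just (false , true))  = # 2
  encode (just (true  , false)) = # 3
  encode (just (true  , true))  = # 4
  decode : Fin 5 → HalveState
  decode zero                         = nothing
  decode (suc zero)                   = just (false , false)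
  decode (suc (suc zero))             = just (false , true)
  decode (suc (suc (suc zero)))       = just (true  , false)
  decode (suc (suc (suc (suc zero)))) = just (true  , true)
  decode-encode : ∀ s → decode (encode s) ≡ s
  decode-encode nothing                = refl
  decode-encode (just (false , false)) = refl
  decode-encode (just (false , true))  = refl
  decode-encode (just (true  , false)) = refl
  decode-encode (just (true  , true))  = refl

module Halve = TwoTrackDFA halveStates halveStep nothing (λ _ _ → refl) (just (false , false)) halveFinal refl

halve-run : ∀ p q y′ y {p₂ q₂} → length y′ ≡ length y → Halve.run (just (p , q)) y′ y ≡ just (p₂ , q₂) →
            bit p + count isL y ≡ 2 * count isL y′ + bit p₂ × bit q + count isR y ≡ 2 * count isR y′ + bit q₂
halve-run p q []        []      _  refl = +-identityʳ (bit p) , +-identityʳ (bit q)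
halve-run p q (a′ ∷ y′) (a ∷ y) eq end
  with carry p (isL a) (isL a′) in eL | carry q (isR a) (isR a′) in eR
... | just p₁ | just q₁ = let ihL , ihR = halve-run p₁ q₁ y′ y (suc-injective eq) end in
  carry-chain (bit p) (bit (isL a)) (bit (isL a′)) (count isL y) (count isL y′) (carry-sound eL) ihL ,
  carry-chain (bit q) (bit (isR a)) (bit (isR a′)) (count isR y) (count isR y′) (carry-sound eR) ihR
... | nothing | _       with () ← trans (sym (Halve.run-dead y′ y)) end
... | just _  | nothing with () ← trans (sym (Halve.run-dead y′ y)) end

record IsHalfOf (y′ y : List G) : Set where
  constructor isHalfOf
  field
    remainder : ℕ
    countL    : count isL y ≡ 2 * count isL y′ + remainder
    countR    : count isR y ≡ 2 * count isR y′ + remainder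

halve-sound : ∀ y′ y → accepts Halve.automaton (conv (y′ ∷ y ∷ [])) ≡ true → IsHalfOf y′ y
halve-sound y′ y accepted with same-length , f ← Halve.accepts-sound y′ y accepted
                          with Halve.run (just (false , false)) y′ y in end
... | just (p₂ , q₂) with p₂ Bool.≟ q₂ | f
...   | yes refl | _ = let countL , countR = halve-run false false y′ y same-length end in
  isHalfOf (bit p₂) countL countR

toggle : ℕ → Bool → Bool
toggle zero    p = p
toggle (suc n) p = toggle n (not p)

halfOf : Bool → Bool → List G → List G
halfOf p q []      = []
halfOf p q (L ∷ y) = (if p then L else M) ∷ halfOf (not p) q y
halfOf p q (R ∷ y) = (if q then R else M) ∷ halfOf p (not q) y
halfOf p q (M ∷ y) = M ∷ halfOf p q y

half : List G → List G
half = halfOf false false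

halfOf-length : ∀ p q y → length (halfOf p q y) ≡ length y
halfOf-length p q []      = refl
halfOf-length p q (L ∷ y) = cong suc (halfOf-length (not p) q y)
halfOf-length p q (R ∷ y) = cong suc (halfOf-length p (not q) y)
halfOf-length p q (M ∷ y) = cong suc (halfOf-length p q y)

halfOf-run : ∀ p q y → Halve.run (just (p , q)) (halfOf p q y) y ≡
                       just (toggle (count isL y) p , toggle (count isR y) q)
halfOf-run p     q     []      = refl
halfOf-run false false (L ∷ y) = halfOf-run true  false y
halfOf-run false true  (L ∷ y) = halfOf-run true  true  y
halfOf-run true  false (L ∷ y) = halfOf-run false false y
halfOf-run true  true  (L ∷ y) = halfOf-run false true  y
halfOf-run false false (R ∷ y) = halfOf-run false true  y
halfOf-run false true  (R ∷ y) = halfOf-run false false y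
halfOf-run true  false (R ∷ y) = halfOf-run true  true  y
halfOf-run true  true  (R ∷ y) = halfOf-run true  false y
halfOf-run false false (M ∷ y) = halfOf-run false false y
halfOf-run false true  (M ∷ y) = halfOf-run false true  y
halfOf-run true  false (M ∷ y) = halfOf-run true  false y
halfOf-run true  true  (M ∷ y) = halfOf-run true  true  y

halve-complete : ∀ y → Balanced y → accepts Halve.automaton (conv (half y ∷ y ∷ [])) ≡ true
halve-complete y balanced = Halve.accepts-complete (half y) y (halfOf-length false false y)
  (trans (cong halveFinal (halfOf-run false false y))
         (dec-true (toggle (count isL y) false Bool.≟ toggle (count isR y) false)
                   (cong (λ n → toggle n false) balanced)))

halves-balanced : ∀ {y′ y} → IsHalfOf y′ y → Balanced y′ ⇔ Balanced y
halves-balanced {y′} {y} (isHalfOf r eL eR) = mk⇔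
  (λ balanced′ → trans eL (trans (cong (λ n → 2 * n + r) balanced′) (sym eR)))
  (λ balanced → *-cancelˡ-≡ (count isL y′) (count isR y′) 2
    (+-cancelʳ-≡ r (2 * count isL y′) (2 * count isR y′) (trans (sym eL) (trans balanced eR))))

halves-weight : ∀ {y′ y} → IsHalfOf y′ y → 2 * weight y′ ≤ weight y
halves-weight {y′} {y} (isHalfOf r eL eR) = begin
  2 * weight y′                                   ≡⟨ *-distribˡ-+ 2 (count isL y′) (count isR y′) ⟩
  2 * count isL y′ + 2 * count isR y′             ≤⟨ +-mono-≤ (m≤m+n (2 * count isL y′) r)
                                                               (m≤m+n (2 * count isR y′) r) ⟩
  (2 * count isL y′ + r) + (2 * count isR y′ + r) ≡⟨ cong₂ _+_ eL eR ⟨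
  weight y                                        ∎
  where open ≤-Reasoning

halving-decreases : ∀ {m n} → 0 < n → 2 * m ≤ n → m < n
halving-decreases {zero}  0<n _    = 0<n
halving-decreases {suc m} _   2m≤n = ≤-trans (s≤s (m<m+n m z<s)) 2m≤n

middleStep : Bool → G → Bool
middleStep b M = b
middleStep _ _ = false

allMiddle : DFA (Vec (Maybe G) 1)
allMiddle = dfa (↔⇒↪ (↔-sym 2↔Bool)) true (column₁ middleStep) id

foldl-middleStep-false : ∀ y → foldl middleStep false y ≡ false
foldl-middleStep-false []      = refl
foldl-middleStep-false (L ∷ y) = foldl-middleStep-false y
foldl-middleStep-false (R ∷ y) = foldl-middleStep-false y
foldl-middleStep-false (M ∷ y) = foldl-middleStep-false y

foldl-middleStep⇔weight≡0 : ∀ y → foldl middleStep true y ≡ true ⇔ weight y ≡ 0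
foldl-middleStep⇔weight≡0 y = mk⇔ (to y) (from y)
  where
  to : ∀ y → foldl middleStep true y ≡ true → weight y ≡ 0
  to []      _ = refl
  to (M ∷ y) e = to y e
  to (L ∷ y) e with () ← trans (sym (foldl-middleStep-false y)) e
  to (R ∷ y) e with () ← trans (sym (foldl-middleStep-false y)) e
  from : ∀ y → weight y ≡ 0 → foldl middleStep true y ≡ true
  from []      _ = refl
  from (M ∷ y) e = from y e
  from (R ∷ y) e = ⊥-elim (m+1+n≢0 (count isL y) e)

allMiddle-accepts : ∀ y → accepts allMiddle (conv (y ∷ [])) ≡ true ⇔ weight y ≡ 0
allMiddle-accepts y
  rewrite accepts-dfa (↔⇒↪ (↔-sym 2↔Bool)) true (column₁ middleStep) id (conv (y ∷ []))
        | conv-run₁ middleStep true y = foldl-middleStep⇔weight≡0 y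

-- Palindromes

!?-lookup : ∀ {A : Set} (w : List A) (i : Fin (length w)) → w !? toℕ i ≡ just (lookup w i)
!?-lookup (a ∷ w) zero    = refl
!?-lookup (a ∷ w) (suc i) = !?-lookup w i

!?-map : ∀ {A B : Set} (f : A → B) (w : List A) i → map f w !? i ≡ Maybe.map f (w !? i)
!?-map f []      i       = refl
!?-map f (a ∷ w) zero    = refl
!?-map f (a ∷ w) (suc i) = !?-map f w i

MirrorMismatch : ∀ {A : Set} → List A → ℕ → ℕ → Set
MirrorMismatch w a b = a + suc b ≡ length w × w !? a ≢ w !? b

toℕ+toℕ-opposite : ∀ {n} (i : Fin n) → toℕ i + suc (toℕ (opposite i)) ≡ n
toℕ+toℕ-opposite {n} i = begin
  toℕ i + suc (toℕ (opposite i))  ≡⟨ cong (λ m → toℕ i + suc m) (opposite-prop i) ⟩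
  toℕ i + suc (n ∸ suc (toℕ i))   ≡⟨ +-suc (toℕ i) _ ⟩
  suc (toℕ i) + (n ∸ suc (toℕ i)) ≡⟨ m+[n∸m]≡n (toℕ<n i) ⟩
  n                               ∎
  where open ≡-Reasoning

nonpalindrome⇔mirrorMismatch : ∀ w → NONPALINDROME w ⇔ ∃₂ (MirrorMismatch w)
nonpalindrome⇔mirrorMismatch w = mk⇔ to from
  where
  to : NONPALINDROME w → ∃₂ (MirrorMismatch w)
  to nonpal with i , i≢opposite ← ¬∀⟶∃¬ (length w) _ (λ i → lookup w i Bool.≟ lookup w (opposite i)) nonpal =
    toℕ i , toℕ (opposite i) , toℕ+toℕ-opposite i ,
    λ e → i≢opposite (just-injective (trans (sym (!?-lookup w i)) (trans e (!?-lookup w (opposite i)))))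
  from : ∃₂ (MirrorMismatch w) → NONPALINDROME w
  from (a , b , mirror , a≢b) palindrome = a≢b (begin
    w !? a                       ≡⟨ cong (w !?_) (toℕ-fromℕ< a<n) ⟨
    w !? toℕ i                   ≡⟨ !?-lookup w i ⟩
    just (lookup w i)            ≡⟨ cong just (palindrome i) ⟩
    just (lookup w (opposite i)) ≡⟨ !?-lookup w (opposite i) ⟨
    w !? toℕ (opposite i)        ≡⟨ cong (w !?_) opposite≡b ⟩
    w !? b                       ∎)
    where
    open ≡-Reasoning
    a<n : a < length w
    a<n = subst (a <_) mirror (m<m+n a z<s)
    i : Fin (length w)
    i = fromℕ< a<n
    opposite≡b : toℕ (opposite i) ≡ b
    opposite≡b = suc-injective (+-cancelˡ-≡ a _ _
      (trans (cong (_+ suc (toℕ (opposite i))) (sym (toℕ-fromℕ< a<n)))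
             (trans (toℕ+toℕ-opposite i) (sym mirror))))

mirrorMismatch-map : ∀ {A B : Set} {f : A → B} → Injective _≡_ _≡_ f → ∀ w a b →
                     MirrorMismatch w a b ⇔ MirrorMismatch (map f w) a b
mirrorMismatch-map {f = f} f-inj w a b = mk⇔
  (λ (mirror , a≢b) → trans mirror (sym (length-map f w)) ,
     λ e → a≢b (map-injective f-inj (trans (sym (!?-map f w a)) (trans e (!?-map f w b)))))
  (λ (mirror , a≢b) → trans mirror (length-map f w) ,
     λ e → a≢b (trans (!?-map f w a) (trans (cong (Maybe.map f) e) (sym (!?-map f w b)))))

mirrorMismatch-ordered : ∀ {A : Set} (w : List A) a b → MirrorMismatch w a b →
                         ∃₂ λ p k → MirrorMismatch w p (suc (p + k))
mirrorMismatch-ordered w a b (mirror , a≢b) with compare a b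
... | less    a k = a , k , mirror , a≢b
... | equal   a   = ⊥-elim (a≢b refl)
... | greater b k = b , k , trans (swap b (suc (b + k))) mirror , a≢b ∘ sym
  where
  swap : ∀ m n → m + suc n ≡ n + suc m
  swap m n = trans (+-suc m n) (trans (cong suc (+-comm m n)) (sym (+-suc n m)))

mirror-length : ∀ p k → p + suc (suc (p + k)) ≡ p + (2 + k + p)
mirror-length p k = cong (λ m → p + suc (suc m)) (+-comm p k)

-- The machine

pattern input = zero
pattern tape  = suc zero

program : Fin 6 → Instr 1 2 5
program zero                               = read input
program (suc zero)                         = rel tape 1 (input ∷ []) Guess.automaton Guess.bounded
program (suc (suc zero))                   = ifgoto 1 (tape ∷ []) allMiddle (# 5)
program (suc (suc (suc zero)))             = rel tape 1 (tape ∷ []) Halve.automaton Halve.bounded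
program (suc (suc (suc (suc zero))))       = goto (# 2)
program (suc (suc (suc (suc (suc zero))))) = accept

machine : NARM
machine = record { g = 1 ; r = 2 ; L = 5 ; prog = program }

emb-injective : Injective _≡_ _≡_ (emb {1})
emb-injective {false} {false} _ = refl
emb-injective {true}  {true}  _ = refl

n<2^[1+⌊log₂n⌋] : ∀ n → n < 2 ^ suc ⌊log₂ n ⌋
n<2^[1+⌊log₂n⌋] n with n <? 2 ^ suc ⌊log₂ n ⌋
... | yes n< = n<
... | no  n≮ = contradiction (subst (_≤ ⌊log₂ n ⌋) (⌊log₂[2^n]⌋≡n (suc ⌊log₂ n ⌋)) (⌊log₂⌋-mono-≤ (≮⇒≥ n≮)))
                             (<-irrefl refl)

module Analysis (w : List Bool) where
  open Run machine w

  x : List G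
  x = map emb w

  accept-is-final : ∀ {ρ c} → ¬ Step (# 5 , ρ) c
  accept-is-final (s-read () _)
  accept-is-final (s-write () _)
  accept-is-final (s-const () _)
  accept-is-final (s-copy () _)
  accept-is-final (s-rel _ () _ _)
  accept-is-final (s-goto ())
  accept-is-final (s-if-t () _)
  accept-is-final (s-if-f () _ _)

  loop-balanced : ∀ {t ρ} → AccRun t (# 2 , ρ) → Balanced (ρ tape)
  loop-balanced {ρ = ρ} (step (s-if-t refl accepted) _) =
    let weight≡0 = Equivalence.to (allMiddle-accepts (ρ tape)) accepted in
    trans (m+n≡0⇒m≡0 (count isL (ρ tape)) weight≡0) (sym (m+n≡0⇒n≡0 (count isL (ρ tape)) weight≡0))
  loop-balanced {ρ = ρ} (step (s-if-f refl _ refl) (step (s-rel y′ refl halved refl) (step (s-goto refl) run))) =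
    Equivalence.to (halves-balanced (halve-sound y′ (ρ tape) halved)) (loop-balanced run)

  accepted-nonpalindrome : ∀ {t} → AccRun t init → NONPALINDROME w
  accepted-nonpalindrome (step (s-read refl refl) (step (s-rel y refl guessed refl) run))
    with same-length , p , k , s , refl , mismatch ← guess-sound y x guessed
    with refl ← trans (sym (guess-countR p k s)) (trans (sym (loop-balanced run)) (guess-countL p k s)) =
    Equivalence.from (nonpalindrome⇔mirrorMismatch w) (p , suc (p + k) ,
      Equivalence.from (mirrorMismatch-map emb-injective w p (suc (p + k)))
        (trans (mirror-length p k) (trans (sym (guess-length p k p)) same-length) , mismatch))

  loop-time : ∀ {t ρ} e → weight (ρ tape) < 2 ^ e → AccRun t (# 2 , ρ) → t ≤ 3 * e + 2
  loop-time e _ (step (s-if-t refl _) (done refl))     = m≤n+m 2 (3 * e)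
  loop-time e _ (step (s-if-t refl _) (step halted _)) = ⊥-elim (accept-is-final halted)
  loop-time {ρ = ρ} zero weight<1 (step (s-if-f refl rejected refl) _)
    with () ← trans (sym rejected) (Equivalence.from (allMiddle-accepts (ρ tape)) (n<1⇒n≡0 weight<1))
  loop-time {ρ = ρ} (suc e) weight<
            (step (s-if-f refl _ refl) (step (s-rel y′ refl halved refl) (step (s-goto refl) run))) =
    ≤-trans (s≤s (s≤s (s≤s (loop-time e weight′< run)))) (≤-reflexive (cong (_+ 2) (sym (*-suc 3 e))))
    where
    weight′< : weight y′ < 2 ^ e
    weight′< = *-cancelˡ-< 2 (weight y′) (2 ^ e)
                 (≤-<-trans (halves-weight (halve-sound y′ (ρ tape) halved)) weight<)

  accepted-time : ∀ {t} → AccRun t init → t ≤ 2 + (3 * suc ⌊log₂ length w ⌋ + 2)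
  accepted-time (step (s-read refl refl) (step (s-rel y refl guessed refl) run)) =
    s≤s (s≤s (loop-time (suc ⌊log₂ length w ⌋) weight< run))
    where
    weight< : weight y < 2 ^ suc ⌊log₂ length w ⌋
    weight< = ≤-<-trans (weight≤length y)
      (subst (_< 2 ^ suc ⌊log₂ length w ⌋)
             (sym (trans (proj₁ (guess-sound y x guessed)) (length-map emb w)))
             (n<2^[1+⌊log₂n⌋] (length w)))

  loop-accepts : ∀ ρ → Acc _<_ (weight (ρ tape)) → Balanced (ρ tape) → ∃ λ t → AccRun t (# 2 , ρ)
  loop-accepts ρ (acc rec) balanced with accepts allMiddle (conv (ρ tape ∷ [])) in test
  ... | true  = 2 , step (s-if-t refl test) (done refl)
  ... | false =
    let t , run = loop-accepts (upd ρ tape (half (ρ tape))) (rec shrinks)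
                               (Equivalence.from (halves-balanced halves) balanced) in
    3 + t , step (s-if-f refl test refl) (step (s-rel (half (ρ tape)) refl halved refl) (step (s-goto refl) run))
    where
    halved : accepts Halve.automaton (conv (half (ρ tape) ∷ ρ tape ∷ [])) ≡ true
    halved = halve-complete (ρ tape) balanced
    halves : IsHalfOf (half (ρ tape)) (ρ tape)
    halves = halve-sound (half (ρ tape)) (ρ tape) halved
    weight≢0 : weight (ρ tape) ≢ 0
    weight≢0 weight≡0 with () ← trans (sym test) (Equivalence.from (allMiddle-accepts (ρ tape)) weight≡0)
    shrinks : weight (half (ρ tape)) < weight (ρ tape)
    shrinks = halving-decreases (n≢0⇒n>0 weight≢0) (halves-weight halves)

  nonpalindrome-accepted : NONPALINDROME w → Accepts
  nonpalindrome-accepted nonpal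
    with a , b , mirror ← Equivalence.to (nonpalindrome⇔mirrorMismatch w) nonpal
    with p , k , len , mismatch ← mirrorMismatch-ordered x a b
                                    (Equivalence.to (mirrorMismatch-map emb-injective w a b) mirror) =
    let t , run = loop-accepts _ (<-wellFounded _) (trans (guess-countL p k p) (sym (guess-countR p k p))) in
    2 + t , step (s-read refl refl) (step (s-rel (guess p k p) refl guessed refl) run)
    where
    guessed : accepts Guess.automaton (conv (guess p k p ∷ x ∷ [])) ≡ true
    guessed = guess-complete p k p x (trans (sym len) (mirror-length p k)) mismatch

2≤n⇒1≤⌊log₂n⌋ : ∀ {n} → 2 ≤ n → 1 ≤ ⌊log₂ n ⌋
2≤n⇒1≤⌊log₂n⌋ {n} 2≤n = subst (_≤ ⌊log₂ n ⌋) (⌊log₂[2^n]⌋≡n 1) (⌊log₂⌋-mono-≤ 2≤n)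

2+[3*[1+l]+2]≤10*l : ∀ l → 1 ≤ l → 2 + (3 * suc l + 2) ≤ 10 * l
2+[3*[1+l]+2]≤10*l (suc m) _ = begin
  2 + (3 * suc (suc m) + 2) ≡⟨ expand m ⟩
  10 + 3 * m                ≤⟨ +-monoʳ-≤ 10 (*-monoˡ-≤ m {3} {10} (s≤s (s≤s (s≤s z≤n)))) ⟩
  10 + 10 * m               ≡⟨ *-suc 10 m ⟨
  10 * suc m                ∎
  where
  open ≤-Reasoning
  expand : ∀ m → 2 + (3 * suc (suc m) + 2) ≡ 10 + 3 * m
  expand = solve-∀

mainTheorem11 : BNAL logn NONPALINDROME
mainTheorem11 = machine ,
  (λ w → mk⇔ (Analysis.nonpalindrome-accepted w) (λ (_ , run) → Analysis.accepted-nonpalindrome w run)) ,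
  10 , 2 , λ w t 2≤n run →
    ≤-trans (Analysis.accepted-time w run) (2+[3*[1+l]+2]≤10*l _ (2≤n⇒1≤⌊log₂n⌋ 2≤n))
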